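{- From a given finite string automaton $\mathcal A$ over an alphabet $\Sigma$ with $0,1,\sharp\in\Sigma$ one can effectively construct a tree automaton $\mathcal B$ over $\Sigma$ such that for every $t\in\mathcal T_{\mathsf{lef}}$ and every word $v\in\Sigma^*$, the number of successful runs of $\mathcal A$ on the string $\mathsf{word}(t)\sharp v$ equals the number of successful runs of $\mathcal B$ on the tree $\mathsf{tree}(\mathsf{word}(t)\sharp v)$.
   Context: String automaton $\mathcal A=(Q,\Sigma,\Delta,I,F)$, $\Delta\subseteq Q\times\Sigma\times Q$; a successful run on a nonempty word $a_1\cdots a_n$ is a sequence of transitions $(q_0,a_1,q_1)\cdots(q_{n-1},a_n,q_n)$ with $q_0\in I$, $q_n\in F$. Finite $\Sigma$-labeled binary trees are pairs $(T,\lambda)$, $T$ a nonempty finite prefix-closed subset of $\{0,1\}^*$, $\lambda:T\to\Sigma$; $\mathsf{fr}(T)=T\{0,1\}\setminus T$, $\mathrm{cl}(T)=T\cup\mathsf{fr}(T)$. A tree automaton is $(Q,\Delta,I,F)$ with $\Delta\subseteq(Q\setminus F)\times\Sigma\times Q\times Q$; a successful run on $(T,\lambda)$ is a map $\rho:\mathrm{cl}(T)\to Q$ with $\rho(\varepsilon)\in I$, $\rho(\mathsf{fr}(T))\subseteq F$, and $(\rho(d),\lambda(d),\rho(d0),\rho(d1))\in\Delta$ for all $d\in T$. Unlabeled trees are identified with trees all of whose nodes are labeled $\sharp$. $\mathcal T_{\mathsf{bin}}$: finite binary trees $t$ with $u0\in t\iff u1\in t$ for all $u\in t$; $\mathcal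 T_{\mathsf{lef}}=\{\{\varepsilon\}\cup0u\mid u\in\mathcal T_{\mathsf{bin}}\}$. For $t\in\mathcal T_{\mathsf{bin}}$: $\mathsf{word}(\{\varepsilon\})=\varepsilon$ and $\mathsf{word}(\{\varepsilon\}\cup0t_1\cup1t_2)=0\,\mathsf{word}(t_1)\,1\,0\,\mathsf{word}(t_2)\,1$; for $t=\{\varepsilon\}\cup0u\in\mathcal T_{\mathsf{lef}}$, $\mathsf{word}(t)=0\,\mathsf{word}(u)\,1$. For $w=u\sharp v$ with $u=\mathsf{word}(t)$, $t\in\mathcal T_{\mathsf{lef}}$, $v=a_1\cdots a_m\in\Sigma^*$, $\mathsf{tree}(w)=(T,\lambda)$ with $T=t\cup\{1^i\mid1\le i\le m\}$, $\lambda(1^i)=a_i$ for $1\le i\le m$ and $\lambda(x)=\sharp$ otherwise. -}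

module Defs where

open import Data.Nat using (ℕ)
open import Data.Fin using (Fin)
open import Data.Bool using (Bool; true; false; T)
open import Data.List using (List; []; _∷_; _++_)
open import Data.Maybe using (Maybe; just; nothing)
open import Data.Product using (Σ; _×_)
open import Data.Empty using (⊥)
open import Relation.Binary.PropositionalEquality using (_≡_; _≢_)

record Alphabet : Set where
  field
    size  : ℕ
    c0    : Fin size
    c1    : Fin size
    sharp : Fin size
    c0≢c1     : c0 ≢ c1
    c0≢sharp  : c0 ≢ sharp
    c1≢sharp  : c1 ≢ sharp
open Alphabet public

record StrAut (k : ℕ) : Set where
  field
    states : ℕ
    Δ      : Fin states → Fin k → Fin states → Bool
    I      : Fin states → Bool
    F      : Fin states → Bool
open StrAut public

StrRunFrom : {k : ℕ} (A : StrAut k) → Fin (states A) → List (Fin k) → Set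
StrRunFrom A q []      = T (F A q)
StrRunFrom A q (a ∷ w) = Σ (Fin (states A)) λ q' → T (Δ A q a q') × StrRunFrom A q' w

StrRun : {k : ℕ} (A : StrAut k) → List (Fin k) → Set
StrRun A []      = ⊥
StrRun A (a ∷ w) = Σ (Fin (states A)) λ q₀ → T (I A q₀) × StrRunFrom A q₀ (a ∷ w)

-- Finite Σ-labeled binary trees (T, λ): T a nonempty finite prefix-closed
-- subset of {0,1}*.  An absent child is a
-- frontier node (element of fr(T)).

data LTree (k : ℕ) : Set where
  node : Fin k → Maybe (LTree k) → Maybe (LTree k) → LTree k

record TreeAut (k : ℕ) : Set where
  field
    tstates : ℕ
    tΔ      : Fin tstates → Fin k → Fin tstates → Fin tstates → Bool
    tI      : Fin tstates → Bool
    tF      : Fin tstates → Bool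
    tΔ-nonfinal : ∀ q a p r → T (tΔ q a p r) → tF q ≡ false
open TreeAut public

mutual
  TreeRunFrom : {k : ℕ} (B : TreeAut k) → Fin (tstates B) → LTree k → Set
  TreeRunFrom B q (node a l r) =
    Σ (Fin (tstates B)) λ p₀ → Σ (Fin (tstates B)) λ p₁ →
      T (tΔ B q a p₀ p₁) × TreeRunFromM B p₀ l × TreeRunFromM B p₁ r

  TreeRunFromM : {k : ℕ} (B : TreeAut k) → Fin (tstates B) → Maybe (LTree k) → Set
  TreeRunFromM B p nothing  = T (tF B p)
  TreeRunFromM B p (just t) = TreeRunFrom B p t

TreeRun : {k : ℕ} (B : TreeAut k) → LTree k → Set
TreeRun B t = Σ (Fin (tstates B)) λ q → T (tI B q) × TreeRunFrom B q t

data Bin : Set where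
  leaf : Bin
  br   : Bin → Bin → Bin

-- T_lef = { {ε} ∪ 0u | u ∈ T_bin }; such a tree is given by its u ∈ T_bin.

wordBin : (Al : Alphabet) → Bin → List (Fin (size Al))
wordBin Al leaf       = []
wordBin Al (br t₁ t₂) =
  c0 Al ∷ (wordBin Al t₁ ++ (c1 Al ∷ c0 Al ∷ (wordBin Al t₂ ++ (c1 Al ∷ []))))

wordLef : (Al : Alphabet) → Bin → List (Fin (size Al))
wordLef Al u = c0 Al ∷ (wordBin Al u ++ (c1 Al ∷ []))

binTree : (Al : Alphabet) → Bin → LTree (size Al)
binTree Al leaf       = node (sharp Al) nothing nothing
binTree Al (br t₁ t₂) = node (sharp Al) (just (binTree Al t₁)) (just (binTree Al t₂))

spine : (Al : Alphabet) → List (Fin (size Al)) → Maybe (LTree (size Al))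
spine Al []      = nothing
spine Al (a ∷ v) = just (node a nothing (spine Al v))

treeOf : (Al : Alphabet) → Bin → List (Fin (size Al)) → LTree (size Al)
treeOf Al u v = node (sharp Al) (just (binTree Al u)) (spine Al v)

-- B guesses a run of A on word(t) ♯ v and spreads its states over the nodes of
-- tree(word(t) ♯ v). A node of u in state  bin a y  asserts that A reads word(u′) 1 from a
-- to y, where u′ is its subtree: the node itself reads the final 1 and the 0 in front of
-- each child. The root, in state  root q₀, reads the leading 0 and ♯; a node of the right
-- spine in state  letter x  reads its label from x; the state  halt z  after the last
-- letter is final iff z is. Every state of the string run is stored exactly once and B
-- checks exactly the transitions of A, so the two kinds of runs are in bijection. The
-- bijection is built bottom-up for runs of A followed by an arbitrary condition K on the
-- state they end in.

module Submission where

open import Defs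
open import Data.Bool using (Bool; true; false; T; _∧_)
open import Data.Fin using (Fin)
open import Data.Fin.Properties using (+↔⊎; *↔×; 1↔⊤)
open import Data.List using (List; []; _∷_; _++_)
open import Data.List.Properties using (++-assoc)
open import Data.Maybe using (Maybe; just; nothing)
open import Data.Nat using (ℕ; _+_; _*_)
open import Data.Product using (Σ; _×_; _,_; proj₂)
open import Data.Product.Function.Dependent.Propositional using (Σ-↔)
open import Data.Product.Function.NonDependent.Propositional using (_×-↔_)
open import Data.Sum using (_⊎_; inj₁; inj₂)
open import Data.Sum.Function.Propositional using (_⊎-↔_)
open import Data.Unit using (⊤; tt)
open import Function using (_∘_)
open import Function.Bundles using (_↔_; mk↔ₛ′; Inverse)
open import Function.Properties.Inverse using (↔-refl; ↔-sym; ↔-trans)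
open import Function.Related.Propositional using (module EquationalReasoning)
open import Function.Related.TypeIsomorphisms using (Σ-assoc)
open import Relation.Binary.PropositionalEquality using (_≡_; refl; cong)

T-∧↔ : ∀ {x y} → T (x ∧ y) ↔ (T x × T y)
T-∧↔ {true}  = mk↔ₛ′ (tt ,_) proj₂ (λ _ → refl) (λ _ → refl)
T-∧↔ {false} = mk↔ₛ′ (λ ()) (λ { (() , _) }) (λ { (() , _) }) (λ ())

Σ-cong : {A : Set} {P P′ : A → Set} → (∀ {x} → P x ↔ P′ x) → Σ A P ↔ Σ A P′
Σ-cong = Σ-↔ ↔-refl

-- When preimage is defined by matching on the constructors forming c, the last
-- hypothesis holds by refl.
Σ-image : {X Q : Set} {P : Q → Set} (c : X → Q)
  (preimage : ∀ {q} → P q → Σ X λ x → c x ≡ q) →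
  (∀ {x} (p : P (c x)) → preimage p ≡ (x , refl)) →
  Σ Q P ↔ Σ X (P ∘ c)
Σ-image {X} {Q} {P} c preimage preimage-c = mk↔ₛ′ to from to∘from from∘to
  where
  to : Σ Q P → Σ X (P ∘ c)
  to (q , p) with preimage p
  ... | x , refl = x , p
  from : Σ X (P ∘ c) → Σ Q P
  from (x , p) = c x , p
  to∘from : ∀ y → to (from y) ≡ y
  to∘from (x , p) rewrite preimage-c p = refl
  from∘to : ∀ y → from (to y) ≡ y
  from∘to (q , p) with preimage p
  ... | x , refl = refl

record TreeAutOver (k : ℕ) (Q : Set) : Set where
  field
    δ          : Q → Fin k → Q → Q → Bool
    initial    : Q → Bool
    final      : Q → Bool
    δ-nonfinal : ∀ q a p p′ → T (δ q a p p′) → final q ≡ false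

module _ {k : ℕ} {Q : Set} (M : TreeAutOver k Q) where
  open TreeAutOver M

  mutual
    Runs : Q → LTree k → Set
    Runs q (node a l r) = Σ (Q × Q) (RunsWith q a l r)

    RunsWith : Q → Fin k → Maybe (LTree k) → Maybe (LTree k) → Q × Q → Set
    RunsWith q a l r (p , p′) = T (δ q a p p′) × RunsAt p l × RunsAt p′ r

    RunsAt : Q → Maybe (LTree k) → Set
    RunsAt p nothing  = T (final p)
    RunsAt p (just t) = Runs p t

  Runs-nonfinal : ∀ {q} t → Runs q t → final q ≡ false
  Runs-nonfinal {q} (node a _ _) ((p , p′) , d , _) = δ-nonfinal q a p p′ d

  numbered : {n : ℕ} → Fin n ↔ Q → TreeAut k
  numbered {n} e = record
    { tstates     = n
    ; tΔ          = λ i a j j′ → δ (to i) a (to j) (to j′)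
    ; tI          = initial ∘ to
    ; tF          = final ∘ to
    ; tΔ-nonfinal = λ i a j j′ → δ-nonfinal (to i) a (to j) (to j′)
    }
    where open Inverse e

  module _ {n : ℕ} (e : Fin n ↔ Q) where
    open Inverse e using (to)

    mutual
      numbered-runsFrom : ∀ i t → TreeRunFrom (numbered e) i t ↔ Runs (to i) t
      numbered-runsFrom i (node a l r) =
        ↔-trans (↔-sym Σ-assoc)
          (Σ-↔ (e ×-↔ e) λ { {j , j′} →
            ↔-refl ×-↔ numbered-runsAt j l ×-↔ numbered-runsAt j′ r })

      numbered-runsAt : ∀ i m → TreeRunFromM (numbered e) i m ↔ RunsAt (to i) m
      numbered-runsAt i nothing  = ↔-refl
      numbered-runsAt i (just t) = numbered-runsFrom i t

    numbered-runs : ∀ t → TreeRun (numbered e) t ↔ Σ Q (λ q → T (initial q) × Runs q t)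
    numbered-runs t = Σ-↔ e λ {i} → ↔-refl ×-↔ numbered-runsFrom i t

module _ {k : ℕ} (A : StrAut k) where

  Run : (Fin (states A) → Set) → Fin (states A) → List (Fin k) → Set
  Run K q []      = K q
  Run K q (a ∷ w) = Σ (Fin (states A)) λ q′ → T (Δ A q a q′) × Run K q′ w

  StrRunFrom↔Run : ∀ q w → StrRunFrom A q w ↔ Run (T ∘ F A) q w
  StrRunFrom↔Run q []      = ↔-refl
  StrRunFrom↔Run q (a ∷ w) = Σ-cong λ {q′} → ↔-refl ×-↔ StrRunFrom↔Run q′ w

  Run-++ : ∀ K q w w′ → Run K q (w ++ w′) ↔ Run (λ s → Run K s w′) q w
  Run-++ K q []      w′ = ↔-refl
  Run-++ K q (a ∷ w) w′ = Σ-cong λ {q′} → ↔-refl ×-↔ Run-++ K q′ w w′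

wordLef-++-wordLef : ∀ Al t₁ t₂ → wordLef Al t₁ ++ wordLef Al t₂ ≡ wordBin Al (br t₁ t₂)
wordLef-++-wordLef Al t₁ t₂ =
  cong (c0 Al ∷_) (++-assoc (wordBin Al t₁) (c1 Al ∷ []) (wordLef Al t₂))

module Construction (Al : Alphabet) (A : StrAut (size Al)) where

  private
    S = Fin (states A)
    c₀ = c0 Al
    c₁ = c1 Al
    ♯ = sharp Al

  data State : Set where
    root   : S → State
    bin    : S → S → State
    letter : S → State
    blank  : State
    halt   : S → State

  next : (S → Bool) → State → Bool
  next g (letter z) = g z
  next g (halt z)   = g z
  next g _          = false

  δ : State → Fin (size Al) → State → State → Bool
  δ (root q₀)  c (bin a s)  p          = Δ A q₀ c₀ a ∧ next (Δ A s c) p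
  δ (bin a y)  _ (bin a₁ m) (bin a₂ b) = Δ A a c₀ a₁ ∧ (Δ A m c₀ a₂ ∧ Δ A b c₁ y)
  δ (bin a y)  _ blank      blank      = Δ A a c₁ y
  δ (letter x) c blank      p          = next (Δ A x c) p
  δ _          _ _          _          = false

  initial : State → Bool
  initial (root q₀) = I A q₀
  initial _         = false

  final : State → Bool
  final blank    = true
  final (halt z) = F A z
  final _        = false

  δ-nonfinal : ∀ q c p p′ → T (δ q c p p′) → final q ≡ false
  δ-nonfinal (root _)   _ _ _ _ = refl
  δ-nonfinal (bin _ _)  _ _ _ _ = refl
  δ-nonfinal (letter _) _ _ _ _ = refl

  M : TreeAutOver (size Al) State
  M = record { δ = δ ; initial = initial ; final = final ; δ-nonfinal = δ-nonfinal }

  encoding : Fin (states A + (states A * states A + (states A + (1 + states A)))) ↔ State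
  encoding =
    ↔-trans (↔-trans +↔⊎ (↔-refl ⊎-↔ ↔-trans +↔⊎ (*↔× ⊎-↔ ↔-trans +↔⊎
                (↔-refl ⊎-↔ ↔-trans +↔⊎ (1↔⊤ ⊎-↔ ↔-refl)))))
      (mk↔ₛ′ to from to∘from from∘to)
    where
    Code = S ⊎ (S × S) ⊎ S ⊎ ⊤ ⊎ S
    to : Code → State
    to (inj₁ q₀)                      = root q₀
    to (inj₂ (inj₁ (a , y)))          = bin a y
    to (inj₂ (inj₂ (inj₁ x)))         = letter x
    to (inj₂ (inj₂ (inj₂ (inj₁ tt)))) = blank
    to (inj₂ (inj₂ (inj₂ (inj₂ z))))  = halt z
    from : State → Code
    from (root q₀)  = inj₁ q₀
    from (bin a y)  = inj₂ (inj₁ (a , y))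
    from (letter x) = inj₂ (inj₂ (inj₁ x))
    from blank      = inj₂ (inj₂ (inj₂ (inj₁ tt)))
    from (halt z)   = inj₂ (inj₂ (inj₂ (inj₂ z)))
    to∘from : ∀ q → to (from q) ≡ q
    to∘from (root _)   = refl
    to∘from (bin _ _)  = refl
    to∘from (letter _) = refl
    to∘from blank      = refl
    to∘from (halt _)   = refl
    from∘to : ∀ x → from (to x) ≡ x
    from∘to (inj₁ _)                      = refl
    from∘to (inj₂ (inj₁ _))               = refl
    from∘to (inj₂ (inj₂ (inj₁ _)))        = refl
    from∘to (inj₂ (inj₂ (inj₂ (inj₁ _)))) = refl
    from∘to (inj₂ (inj₂ (inj₂ (inj₂ _)))) = refl

  letter-runs : ∀ x c r →
    Runs M (letter x) (node c nothing r) ↔ Σ State (λ p → T (next (Δ A x c) p) × RunsAt M p r)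
  letter-runs x c r =
    ↔-trans (Σ-image (blank ,_) preimage (λ _ → refl))
      (mk↔ₛ′ (λ { (p , d , _ , ρ) → p , d , ρ }) (λ { (p , d , ρ) → p , d , tt , ρ })
             (λ _ → refl) (λ _ → refl))
    where
    preimage : ∀ {pp} → RunsWith M (letter x) c nothing r pp → Σ State λ p → (blank , p) ≡ pp
    preimage {blank , p} _ = p , refl

  spine-runs : ∀ g v →
    Σ State (λ p → T (next g p) × RunsAt M p (spine Al v)) ↔
    Σ S (λ z → T (g z) × Run A (T ∘ F A) z v)
  spine-runs g [] = Σ-image halt preimage (λ _ → refl)
    where
    preimage : ∀ {p} → T (next g p) × T (final p) → Σ S λ z → halt z ≡ p
    preimage {halt z} _ = z , refl
  spine-runs g (c ∷ v) =
    ↔-trans (Σ-image letter preimage (λ _ → refl))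
      (Σ-cong λ {x} → ↔-refl ×-↔ ↔-trans (letter-runs x c (spine Al v)) (spine-runs (Δ A x c) v))
    where
    preimage : ∀ {p} → T (next g p) × Runs M p (node c nothing (spine Al v)) → Σ S λ z → letter z ≡ p
    preimage {letter z} _ = z , refl

  leaf-runs : ∀ a y c → Runs M (bin a y) (node c nothing nothing) ↔ T (Δ A a c₁ y)
  leaf-runs a y c =
    ↔-trans (Σ-image (λ (_ : ⊤) → blank , blank) preimage (λ _ → refl))
      (mk↔ₛ′ (λ { (_ , d , _) → d }) (λ d → tt , d , tt , tt) (λ _ → refl) (λ _ → refl))
    where
    preimage : ∀ {pp} → RunsWith M (bin a y) c nothing nothing pp →
      Σ ⊤ λ _ → (blank , blank) ≡ pp
    preimage {blank , blank} _ = tt , refl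

  branch-runs : ∀ a c l r (K : S → Set) →
    Σ S (λ y → Runs M (bin a y) (node c (just l) (just r)) × K y) ↔
    Σ S λ a₁ → T (Δ A a c₀ a₁) × Σ S λ m → Runs M (bin a₁ m) l ×
      Σ S λ a₂ → T (Δ A m c₀ a₂) × Σ S λ b → Runs M (bin a₂ b) r × Run A K b (c₁ ∷ [])
  branch-runs a c l r K =
    ↔-trans (Σ-cong λ {y} → ↔-trans (Σ-image (children y) preimage (λ _ → refl)) split ×-↔ ↔-refl)
      (mk↔ₛ′ (λ { (y , ((a₁ , m , a₂ , b) , (d₁ , d₂ , d₃) , ρ₁ , ρ₂) , κ) →
                    a₁ , d₁ , m , ρ₁ , a₂ , d₂ , b , ρ₂ , y , d₃ , κ })
             (λ { (a₁ , d₁ , m , ρ₁ , a₂ , d₂ , b , ρ₂ , y , d₃ , κ) →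
                    y , ((a₁ , m , a₂ , b) , (d₁ , d₂ , d₃) , ρ₁ , ρ₂) , κ })
             (λ _ → refl) (λ _ → refl))
    where
    children : S → S × S × S × S → State × State
    children y (a₁ , m , a₂ , b) = bin a₁ m , bin a₂ b
    preimage : ∀ {y pp} → RunsWith M (bin a y) c (just l) (just r) pp →
      Σ (S × S × S × S) λ x → children y x ≡ pp
    preimage {pp = bin a₁ m , bin a₂ b} _ = (a₁ , m , a₂ , b) , refl
    preimage {pp = blank , _} (_ , ρ , _) with () ← Runs-nonfinal M l ρ
    split : ∀ {y} →
      Σ (S × S × S × S) (RunsWith M (bin a y) c (just l) (just r) ∘ children y) ↔
      Σ (S × S × S × S) λ (a₁ , m , a₂ , b) →
        (T (Δ A a c₀ a₁) × T (Δ A m c₀ a₂) × T (Δ A b c₁ y)) ×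
        Runs M (bin a₁ m) l × Runs M (bin a₂ b) r
    split = Σ-cong λ { {a₁ , m , a₂ , b} → ↔-trans T-∧↔ (↔-refl ×-↔ T-∧↔) ×-↔ ↔-refl }

  mutual
    bin-runs : ∀ t a K →
      Σ S (λ y → Runs M (bin a y) (binTree Al t) × K y) ↔ Run A K a (wordBin Al t ++ c₁ ∷ [])
    bin-runs leaf a K = Σ-cong λ {y} → leaf-runs a y ♯ ×-↔ ↔-refl
    bin-runs (br t₁ t₂) a K = begin
      Σ S (λ y → Runs M (bin a y) (binTree Al (br t₁ t₂)) × K y)
        ↔⟨ branch-runs a ♯ (binTree Al t₁) (binTree Al t₂) K ⟩
      Σ S (λ a₁ → T (Δ A a c₀ a₁) × Σ S λ m → Runs M (bin a₁ m) (binTree Al t₁) ×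
        Σ S λ a₂ → T (Δ A m c₀ a₂) × Σ S λ b → Runs M (bin a₂ b) (binTree Al t₂) × K₁ b)
        ↔⟨ Σ-cong (↔-refl ×-↔ Σ-cong (↔-refl ×-↔ lef-runs t₂ _ K₁)) ⟩
      Σ S (λ a₁ → T (Δ A a c₀ a₁) × Σ S λ m → Runs M (bin a₁ m) (binTree Al t₁) ×
        Run A K₁ m (wordLef Al t₂))
        ↔⟨ lef-runs t₁ a _ ⟩
      Run A (λ m → Run A K₁ m (wordLef Al t₂)) a (wordLef Al t₁)
        ↔⟨ ↔-sym (Run-++ A K₁ a (wordLef Al t₁) (wordLef Al t₂)) ⟩
      Run A K₁ a (wordLef Al t₁ ++ wordLef Al t₂)
        ↔⟨ ↔-sym (Run-++ A K a (wordLef Al t₁ ++ wordLef Al t₂) (c₁ ∷ [])) ⟩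
      Run A K a ((wordLef Al t₁ ++ wordLef Al t₂) ++ c₁ ∷ [])
        ≡⟨ cong (λ w → Run A K a (w ++ c₁ ∷ [])) (wordLef-++-wordLef Al t₁ t₂) ⟩
      Run A K a (wordBin Al (br t₁ t₂) ++ c₁ ∷ []) ∎
      where
      open EquationalReasoning
      K₁ : S → Set
      K₁ b = Run A K b (c₁ ∷ [])

    lef-runs : ∀ t q K →
      Σ S (λ a → T (Δ A q c₀ a) × Σ S λ y → Runs M (bin a y) (binTree Al t) × K y) ↔
      Run A K q (wordLef Al t)
    lef-runs t q K = Σ-cong λ {a} → ↔-refl ×-↔ bin-runs t a K

  root-runs : ∀ q₀ c l r → Runs M (root q₀) (node c (just l) r) ↔
    Σ S λ a → T (Δ A q₀ c₀ a) × Σ S λ s → Runs M (bin a s) l ×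
      Σ State λ p → T (next (Δ A s c) p) × RunsAt M p r
  root-runs q₀ c l r =
    ↔-trans (Σ-image children preimage (λ _ → refl))
      (↔-trans (Σ-cong λ { {a , s , p} → T-∧↔ ×-↔ ↔-refl })
        (mk↔ₛ′ (λ { ((a , s , p) , (d₁ , d₂) , ρ₁ , ρ₂) → a , d₁ , s , ρ₁ , p , d₂ , ρ₂ })
               (λ { (a , d₁ , s , ρ₁ , p , d₂ , ρ₂) → (a , s , p) , (d₁ , d₂) , ρ₁ , ρ₂ })
               (λ _ → refl) (λ _ → refl)))
    where
    children : S × S × State → State × State
    children (a , s , p) = bin a s , p
    preimage : ∀ {pp} → RunsWith M (root q₀) c (just l) r pp →
      Σ (S × S × State) λ x → children x ≡ pp
    preimage {pp = bin a s , p} _ = (a , s , p) , refl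

  initial-runs : ∀ t →
    Σ State (λ q → T (initial q) × Runs M q t) ↔ Σ S (λ q₀ → T (I A q₀) × Runs M (root q₀) t)
  initial-runs t = Σ-image root preimage (λ _ → refl)
    where
    preimage : ∀ {q} → T (initial q) × Runs M q t → Σ S λ q₀ → root q₀ ≡ q
    preimage {root q₀} _ = q₀ , refl

  treeOf-runs : ∀ q₀ u v →
    Runs M (root q₀) (treeOf Al u v) ↔ StrRunFrom A q₀ (wordLef Al u ++ ♯ ∷ v)
  treeOf-runs q₀ u v = begin
    Runs M (root q₀) (treeOf Al u v)
      ↔⟨ root-runs q₀ ♯ (binTree Al u) (spine Al v) ⟩
    Σ S (λ a → T (Δ A q₀ c₀ a) × Σ S λ s → Runs M (bin a s) (binTree Al u) ×
      Σ State λ p → T (next (Δ A s ♯) p) × RunsAt M p (spine Al v))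
      ↔⟨ Σ-cong (↔-refl ×-↔ Σ-cong λ {s} → ↔-refl ×-↔ spine-runs (Δ A s ♯) v) ⟩
    Σ S (λ a → T (Δ A q₀ c₀ a) × Σ S λ s → Runs M (bin a s) (binTree Al u) ×
      Run A (T ∘ F A) s (♯ ∷ v))
      ↔⟨ lef-runs u q₀ _ ⟩
    Run A (λ s → Run A (T ∘ F A) s (♯ ∷ v)) q₀ (wordLef Al u)
      ↔⟨ ↔-sym (Run-++ A (T ∘ F A) q₀ (wordLef Al u) (♯ ∷ v)) ⟩
    Run A (T ∘ F A) q₀ (wordLef Al u ++ ♯ ∷ v)
      ↔⟨ ↔-sym (StrRunFrom↔Run A q₀ (wordLef Al u ++ ♯ ∷ v)) ⟩
    StrRunFrom A q₀ (wordLef Al u ++ ♯ ∷ v) ∎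
    where open EquationalReasoning

  B : TreeAut (size Al)
  B = numbered M encoding

  B-correct : ∀ u v → StrRun A (wordLef Al u ++ ♯ ∷ v) ↔ TreeRun B (treeOf Al u v)
  B-correct u v = ↔-sym (begin
    TreeRun B (treeOf Al u v)
      ↔⟨ numbered-runs M encoding (treeOf Al u v) ⟩
    Σ State (λ q → T (initial q) × Runs M q (treeOf Al u v))
      ↔⟨ initial-runs (treeOf Al u v) ⟩
    Σ S (λ q₀ → T (I A q₀) × Runs M (root q₀) (treeOf Al u v))
      ↔⟨ Σ-cong (λ {q₀} → ↔-refl ×-↔ treeOf-runs q₀ u v) ⟩
    StrRun A (wordLef Al u ++ ♯ ∷ v) ∎)
    where open EquationalReasoning

lemma5p9 : (Al : Alphabet) (A : StrAut (size Al)) →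
    Σ (TreeAut (size Al)) λ B →
      (u : Bin) (v : List (Fin (size Al))) →
        StrRun A (wordLef Al u ++ (sharp Al ∷ v)) ↔ TreeRun B (treeOf Al u v)
lemma5p9 Al A = B , B-correct
  where open Construction Al A
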